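{- Assume univalence and propositional truncations. If there is an automorphism $g:\mathcal{U}\to\mathcal{U}$ with $g(\mathbf{0})\neq\mathbf{0}$, then $\neg\neg\prod_{P:\mathcal{U}}\mathrm{isProp}(P)\to P+\neg P$ holds.
   Context: Work in intensional Martin-Löf type theory with $\Pi$-, $\Sigma$-, identity, finite types and natural numbers, a univalent universe $\mathcal{U}$ closed under these, and propositional truncations. $\neg X$ is $X\to\mathbf{0}$, $a\neq b$ is $\neg(a=b)$. $\mathrm{isProp}(P)$ means any two elements of $P$ are equal. An automorphism of $\mathcal{U}$ is a map $\mathcal{U}\to\mathcal{U}$ with a left and a right inverse. -}

{-# OPTIONS --without-K #-}
module Defs where

open import Data.Empty using (⊥)
open import Level using (Level; _⊔_)
open import Data.Product using (Σ; _,_; _×_)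
open import Data.Sum using (_⊎_)
open import Relation.Nullary using (¬_)
open import Relation.Binary.PropositionalEquality using (_≡_; refl)

-- The universe 𝒰 is Agda's Set (= Set₀).

isProp : Set → Set
isProp P = (x y : P) → x ≡ y

-- f has a left inverse and a right inverse (bi-invertible map; the standard
-- notion of equivalence, a proposition under funext).
isEquiv : {a b : Level} {A : Set a} {B : Set b} → (A → B) → Set (a ⊔ b)
isEquiv {A = A} {B = B} f =
  Σ (B → A) (λ h → (x : A) → h (f x) ≡ x) × Σ (B → A) (λ k → (y : B) → f (k y) ≡ y)

_≃_ : Set → Set → Set
A ≃ B = Σ (A → B) isEquiv

idtoeqv : {A B : Set} → A ≡ B → A ≃ B
idtoeqv refl = (λ x → x) , ((λ x → x) , λ _ → refl) , ((λ x → x) , λ _ → refl)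

Univalence : Set₁
Univalence = (A B : Set) → isEquiv (idtoeqv {A} {B})

record PropTrunc : Set₁ where
  field
    ∥_∥      : Set → Set
    ∣_∣      : {A : Set} → A → ∥ A ∥
    ∥∥-isProp : {A : Set} → isProp ∥ A ∥
    ∥∥-rec   : {A P : Set} → isProp P → (A → P) → ∥ A ∥ → P

isAutomorphism : (Set → Set) → Set₁
isAutomorphism g =
  Σ (Set → Set) (λ h → (X : Set) → h (g X) ≡ X) × Σ (Set → Set) (λ k → (X : Set) → g (k X) ≡ X)

LEM : Set₁
LEM = (P : Set) → isProp P → P ⊎ ¬ P

{-# OPTIONS --without-K #-}
-- Let h be the inverse of g and B = h ⊥.  Since g ⊥ ≠ ⊥, B cannot be empty:
-- an empty B would equal ⊥ by univalence, giving g ⊥ = g (h ⊥) = ⊥.  So it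
-- suffices to derive LEM from a point b : B.  Given b, every proposition Q is
-- equivalent to the negation ¬ g (B × Q): if Q holds then B × Q ≃ B, so
-- g (B × Q) = g B = ⊥; conversely if g (B × Q) is empty it equals ⊥, so
-- B × Q = h (g (B × Q)) = h ⊥ = B, and transporting b yields Q.  Negations
-- are ¬¬-stable, hence double-negation elimination holds for propositions,
-- and DNE applied to the proposition P ⊎ ∥ ¬ P ∥ gives LEM.
module Submission where

open import Defs
open import Data.Empty using (⊥; ⊥-elim)
open import Data.Product using (_,_; _×_; proj₁; proj₂)
open import Data.Sum using (_⊎_; inj₁; inj₂; map₂)
open import Function using (id)
open import Level using (Level)
open import Relation.Nullary using (¬_)
open import Relation.Binary.PropositionalEquality
  using (_≡_; refl; sym; cong; subst; module ≡-Reasoning)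

DNE : Set₁
DNE = (Q : Set) → isProp Q → ¬ ¬ Q → Q

-- A type logically equivalent to a negation is ¬¬-stable, because ¬¬¬X → ¬X.
stable-if-negation : {Q X : Set} → (Q → ¬ X) → (¬ X → Q) → ¬ ¬ Q → Q
stable-if-negation to from ¬¬q = from (λ x → ¬¬q (λ q → to q x))

⊥-isProp : isProp ⊥
⊥-isProp ()

-- DNE implies LEM.  Without function extensionality ¬ P need not be a
-- proposition, so the refutation is truncated: P ⊎ ∥ ¬ P ∥ is a proposition
-- that is never refuted, and its ∥ ¬ P ∥ summand still refutes P.
module _ (PT : PropTrunc) where
  open PropTrunc PT

  untruncate-¬ : {P : Set} → ∥ ¬ P ∥ → ¬ P
  untruncate-¬ t p = ∥∥-rec ⊥-isProp (λ ¬p → ¬p p) t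

  truncated-decision-isProp : {P : Set} → isProp P → isProp (P ⊎ ∥ ¬ P ∥)
  truncated-decision-isProp pP (inj₁ p) (inj₁ p′) = cong inj₁ (pP p p′)
  truncated-decision-isProp pP (inj₁ p) (inj₂ t)  = ⊥-elim (untruncate-¬ t p)
  truncated-decision-isProp pP (inj₂ t) (inj₁ p)  = ⊥-elim (untruncate-¬ t p)
  truncated-decision-isProp pP (inj₂ t) (inj₂ t′) = cong inj₂ (∥∥-isProp t t′)

  truncated-decision-¬¬ : {P : Set} → ¬ ¬ (P ⊎ ∥ ¬ P ∥)
  truncated-decision-¬¬ ¬d = ¬d (inj₂ ∣ (λ p → ¬d (inj₁ p)) ∣)

  DNE→LEM : DNE → LEM
  DNE→LEM dne P pP =
    map₂ untruncate-¬
      (dne (P ⊎ ∥ ¬ P ∥) (truncated-decision-isProp pP) truncated-decision-¬¬)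

module _ (U : Univalence) where

  ua : {A B : Set} → A ≃ B → A ≡ B
  ua {A} {B} = proj₁ (proj₂ (U A B))

  empty≡⊥ : {X : Set} → ¬ X → X ≡ ⊥
  empty≡⊥ ¬x = ua ((λ x → ⊥-elim (¬x x)) , ((λ ()) , λ x → ⊥-elim (¬x x)) , ((λ ()) , λ ()))

  ×-inhabited-prop : {A Q : Set} → isProp Q → Q → (A × Q) ≡ A
  ×-inhabited-prop pQ q =
    ua (proj₁ , ((λ a → a , q) , λ { (a , q′) → cong (a ,_) (pQ q q′) })
              , ((λ a → a , q) , λ _ → refl))

left-inverse-is-section : {a b : Level} {A : Set a} {B : Set b}
  (f : A → B) (e : isEquiv f) (y : B) → f (proj₁ (proj₁ e) y) ≡ y
left-inverse-is-section f ((h , hf) , (k , fk)) y = begin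
  f (h y)         ≡⟨ cong (λ z → f (h z)) (sym (fk y)) ⟩
  f (h (f (k y))) ≡⟨ cong f (hf (k y)) ⟩
  f (k y)         ≡⟨ fk y ⟩
  y               ∎
  where open ≡-Reasoning

module _ (U : Univalence) (g : Set → Set) (aut : isAutomorphism g) where

  h : Set → Set
  h = proj₁ (proj₁ aut)

  h∘g : (X : Set) → h (g X) ≡ X
  h∘g = proj₂ (proj₁ aut)

  g∘h : (X : Set) → g (h X) ≡ X
  g∘h = left-inverse-is-section g aut

  B : Set
  B = h ⊥

  B-nonempty : ¬ (g ⊥ ≡ ⊥) → ¬ ¬ B
  B-nonempty g⊥≢⊥ ¬b = g⊥≢⊥ (begin
    g ⊥ ≡⟨ cong g (sym (empty≡⊥ U ¬b)) ⟩
    g B ≡⟨ g∘h ⊥ ⟩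
    ⊥   ∎)
    where open ≡-Reasoning

  DNE-from-point : B → DNE
  DNE-from-point b Q pQ = stable-if-negation encode decode
    where
    open ≡-Reasoning

    encode : Q → ¬ g (B × Q)
    encode q = subst id (begin
      g (B × Q) ≡⟨ cong g (×-inhabited-prop U pQ q) ⟩
      g B       ≡⟨ g∘h ⊥ ⟩
      ⊥         ∎)

    decode : ¬ g (B × Q) → Q
    decode ¬gY = proj₂ (subst id (sym B×Q≡B) b)
      where
      B×Q≡B : (B × Q) ≡ B
      B×Q≡B = begin
        (B × Q)       ≡⟨ sym (h∘g (B × Q)) ⟩
        h (g (B × Q)) ≡⟨ cong h (empty≡⊥ U ¬gY) ⟩
        B             ∎

corollary3p12 : Univalence → PropTrunc → (g : Set → Set) → isAutomorphism g → ¬ (g ⊥ ≡ ⊥) → ¬ ¬ LEM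
corollary3p12 U PT g aut g⊥≢⊥ ¬lem =
  B-nonempty U g aut g⊥≢⊥ (λ b → ¬lem (DNE→LEM PT (DNE-from-point U g aut b)))
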